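{- Let $n\ge4$ be even and suppose $F_1,F_2$ form a $2$-IMOFS$(n;n-2)$. Let $M$ be the $2\times2$ array, indexed by rows $n-1,n$ and columns $n-1,n$, whose $(r,c)$ entry is the ordered pair $F_1[r,c]F_2[r,c]$. Then $M$ is isomorphic to $\begin{bmatrix}00&01\\10&11\end{bmatrix}$, i.e. $M$ can be transformed into this array by a sequence of the operations: swapping its two rows, swapping its two columns, transposing, and interchanging the symbols $0$ and $1$ in one coordinate of all pairs.
   Context: For positive even integers $s<n$, an incomplete frequency square of type $(n;s)$ is an $n\times n$ array indexed by $\{1,\dots,n\}^2$ whose cells in $\{1,\dots,s\}\times\{1,\dots,s\}$ are empty, whose other cells contain $0$ or $1$, and in which every row and every column contains equally many $0$'s and $1$'s. Two such arrays are orthogonal if, when superimposed (on the non-empty cells), each of the ordered pairs $(0,0),(0,1),(1,0),(1,1)$ occurs the same number of times. A $k$-IMOFS$(n;s)$ is a set of $k$ pairwise orthogonal incomplete frequency squares of type $(n;s)$. -}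

module Defs where

open import Data.Nat using (ℕ; zero; suc; _<_; _<ᵇ_; _∸_; _≤_)
open import Data.Nat.Divisibility using (_∣_)
open import Data.Bool using (Bool; true; false; not; _∧_; if_then_else_)
open import Data.Fin using (Fin; toℕ; fromℕ; inject₁)
open import Data.List using (List; []; _∷_; allFin; cartesianProduct)
open import Data.Product using (_×_; _,_; map₁; map₂)
open import Relation.Binary.PropositionalEquality using (_≡_)
open import Relation.Binary.Construct.Closure.ReflexiveTransitive using (Star)

-- Symbols: 0 is represented by false, 1 by true.
-- An n×n array is a function Fin n → Fin n → Bool (0-based indices);
-- values in the empty s×s corner (0-based indices < s) are ignored.

Square : ℕ → Set
Square n = Fin n → Fin n → Bool

cnt : {A : Set} → (A → Bool) → List A → ℕ
cnt p []       = 0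
cnt p (x ∷ xs) = if p x then suc (cnt p xs) else cnt p xs

beq : Bool → Bool → Bool
beq true  b = b
beq false b = not b

filled : {n : ℕ} → ℕ → Fin n → Fin n → Bool
filled s i j = not ((toℕ i <ᵇ s) ∧ (toℕ j <ᵇ s))

rowCount : {n : ℕ} → ℕ → Square n → Fin n → Bool → ℕ
rowCount {n} s F i b = cnt (λ j → filled s i j ∧ beq (F i j) b) (allFin n)

colCount : {n : ℕ} → ℕ → Square n → Fin n → Bool → ℕ
colCount {n} s F j b = cnt (λ i → filled s i j ∧ beq (F i j) b) (allFin n)

record IFS (n s : ℕ) (F : Square n) : Set where
  field
    s-pos    : 0 < s
    s-even   : 2 ∣ s
    n-even   : 2 ∣ n
    s<n      : s < n
    rowBal   : (i : Fin n) → rowCount s F i false ≡ rowCount s F i true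
    colBal   : (j : Fin n) → colCount s F j false ≡ colCount s F j true

pairCount : {n : ℕ} → ℕ → Square n → Square n → Bool → Bool → ℕ
pairCount {n} s F1 F2 b1 b2 =
  cnt (λ { (i , j) → filled s i j ∧ (beq (F1 i j) b1 ∧ beq (F2 i j) b2) })
      (cartesianProduct (allFin n) (allFin n))

Orthogonal : {n : ℕ} → ℕ → Square n → Square n → Set
Orthogonal s F1 F2 =
  (pairCount s F1 F2 false false ≡ pairCount s F1 F2 false true) ×
  (pairCount s F1 F2 false false ≡ pairCount s F1 F2 true false) ×
  (pairCount s F1 F2 false false ≡ pairCount s F1 F2 true true)

record IMOFS2 (n s : ℕ) (F1 F2 : Square n) : Set where
  field
    sq1  : IFS n s F1
    sq2  : IFS n s F2
    orth : Orthogonal s F1 F2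

-- 2×2 arrays of ordered pairs: arr a b c d = [ a b ; c d ]
Pair : Set
Pair = Bool × Bool

data Arr : Set where
  arr : Pair → Pair → Pair → Pair → Arr

swapRows : Arr → Arr
swapRows (arr a b c d) = arr c d a b

swapCols : Arr → Arr
swapCols (arr a b c d) = arr b a d c

transpose : Arr → Arr
transpose (arr a b c d) = arr a c b d

flip1 : Arr → Arr
flip1 (arr a b c d) = arr (map₁ not a) (map₁ not b) (map₁ not c) (map₁ not d)

flip2 : Arr → Arr
flip2 (arr a b c d) = arr (map₂ not a) (map₂ not b) (map₂ not c) (map₂ not d)

data Step : Arr → Arr → Set where
  st-rows  : (M : Arr) → Step M (swapRows M)
  st-cols  : (M : Arr) → Step M (swapCols M)
  st-trans : (M : Arr) → Step M (transpose M)
  st-flip1 : (M : Arr) → Step M (flip1 M)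
  st-flip2 : (M : Arr) → Step M (flip2 M)

Iso : Arr → Arr → Set
Iso = Star Step

target : Arr
target = arr (false , false) (false , true) (true , false) (true , true)

-- the 2×2 array on rows/columns n-1, n (1-based), i.e. 0-based n-2, n-1.
-- (for n < 2 it is irrelevant; we return target.)
corner : (n : ℕ) → Square n → Square n → Arr
corner zero F1 F2 = target
corner (suc zero) F1 F2 = target
corner (suc (suc m)) F1 F2 =
  arr (p x x) (p x y) (p y x) (p y y)
  where
    x : Fin (suc (suc m))
    x = inject₁ (fromℕ m)
    y : Fin (suc (suc m))
    y = fromℕ (suc m)
    p : Fin (suc (suc m)) → Fin (suc (suc m)) → Pair
    p r c = (F1 r c , F2 r c)

module Submission where

-- Write m = n - 2 for the side of the hole and X, Y for the last two rows and columns.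
-- A row meeting the hole has only its two cells in columns X and Y filled, so balance forces
-- them to be complementary, and likewise for columns.  Such a complementary pair of cells
-- carries the superimposed pairs (u,v) and (¬u,¬v), contributing one cell to each of the two
-- pair types (b₁,b₂) with beq b₁ b₂ = beq u v.  Hence every pair count is "arms + corner",
-- and orthogonality gives c₀₀ = c₁₁, c₀₁ = c₁₀ and A + c₀₀ = B + c₀₁ for the corner counts
-- cᵢⱼ, where A and B count the 2m arms on which the two squares agree and disagree.  As the
-- corner has four cells, c₀₀ + c₀₁ = 2, so A + c₀₀ = m + 1 and B + c₀₀ is odd.  On the other
-- hand row X and column X are full, so in each of them F₁ and F₂ have the same number of
-- zeros and hence disagree in an even number of cells; this makes B congruent mod 2 to the
-- number of mixed pairs (01 or 10) in the corner cells (X,Y) and (Y,X).  These parity and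
-- symmetry conditions single out the orbit of the target, which is checked by evaluation.

open import Defs
open import Data.Bool as Bool using (Bool; true; false; not; _∧_; _∨_; T; if_then_else_)
open import Data.Bool.Properties using (T-≡; T-∧; ∧-zeroʳ)
open import Data.Fin as Fin using (Fin; toℕ; fromℕ; inject₁)
open import Data.Fin.Properties using (toℕ-inject₁; toℕ-fromℕ; toℕ<n)
open import Data.List using ([]; _∷_; _++_; map; tabulate; allFin; cartesianProduct)
open import Data.Nat using (ℕ; zero; suc; _+_; _*_; _∸_; _≤_; _<_; _<ᵇ_; _≡ᵇ_; z≤n; s≤s; parity)
open import Data.Nat.Divisibility using (_∣_; divides)
open import Data.Nat.Properties
  using (≡ᵇ⇒≡; ≡⇒≡ᵇ; <⇒<ᵇ; ≤-reflexive; n≤1+n; +-assoc; +-comm; +-suc; +-identityʳ;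
         +-cancelˡ-≡; *-cancelˡ-≡; +-commutativeSemigroup; +-0-commutativeMonoid)
open import Data.Nat.Tactic.RingSolver using (solve-∀)
open import Data.Parity.Base as ℙ using (Parity; 0ℙ; 1ℙ)
import Data.Parity.Properties as ℙₚ
open import Data.Product using (_×_; _,_; proj₁; proj₂)
open import Data.Product.Properties using (≡-dec)
open import Data.Vec.Functional using (Vector; zipWith)
open import Function using (_∘_; id; Equivalence)
open import Relation.Binary.Construct.Closure.ReflexiveTransitive using (ε; _◅_; _◅◅_)
open import Relation.Binary.Definitions using (DecidableEquality)
open import Relation.Binary.PropositionalEquality
open import Relation.Nullary.Decidable using (⌊_⌋; map′; _×-dec_; toWitness; fromWitness)

open import Algebra.Properties.CommutativeSemigroup +-commutativeSemigroup
  using () renaming (interchange to +-interchange)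
open import Algebra.Properties.CommutativeMonoid.Sum +-0-commutativeMonoid
  using (sum; sum-syntax; sum-cong-≗; sum-init-last; ∑-distrib-+; sum-replicate-zero)

𝟙 : Bool → ℕ
𝟙 true  = 1
𝟙 false = 0

cnt-cons : ∀ {A : Set} (p : A → Bool) x xs → cnt p (x ∷ xs) ≡ 𝟙 (p x) + cnt p xs
cnt-cons p x xs with p x
... | true  = refl
... | false = refl

cnt-++ : ∀ {A : Set} (p : A → Bool) xs ys → cnt p (xs ++ ys) ≡ cnt p xs + cnt p ys
cnt-++ p []       ys = refl
cnt-++ p (x ∷ xs) ys = begin
  cnt p (x ∷ xs ++ ys)             ≡⟨ cnt-cons p x (xs ++ ys) ⟩
  𝟙 (p x) + cnt p (xs ++ ys)       ≡⟨ cong (𝟙 (p x) +_) (cnt-++ p xs ys) ⟩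
  𝟙 (p x) + (cnt p xs + cnt p ys)  ≡⟨ +-assoc (𝟙 (p x)) _ _ ⟨
  (𝟙 (p x) + cnt p xs) + cnt p ys  ≡⟨ cong (_+ cnt p ys) (cnt-cons p x xs) ⟨
  cnt p (x ∷ xs) + cnt p ys        ∎
  where open ≡-Reasoning

cnt-map : ∀ {A B : Set} (p : B → Bool) (f : A → B) xs → cnt p (map f xs) ≡ cnt (p ∘ f) xs
cnt-map p f []       = refl
cnt-map p f (x ∷ xs) = trans (cnt-cons p (f x) (map f xs))
  (trans (cong (𝟙 (p (f x)) +_) (cnt-map p f xs)) (sym (cnt-cons (p ∘ f) x xs)))

cnt-tabulate : ∀ {A : Set} {n} (p : A → Bool) (f : Fin n → A) →
               cnt p (tabulate f) ≡ ∑[ i < n ] 𝟙 (p (f i))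
cnt-tabulate {n = zero}  p f = refl
cnt-tabulate {n = suc n} p f = trans (cnt-cons p (f Fin.zero) (tabulate (f ∘ Fin.suc)))
  (cong (𝟙 (p (f Fin.zero)) +_) (cnt-tabulate p (f ∘ Fin.suc)))

cnt-allFin : ∀ {n} (p : Fin n → Bool) → cnt p (allFin n) ≡ ∑[ i < n ] 𝟙 (p i)
cnt-allFin p = cnt-tabulate p id

cnt-allFin² : ∀ {n} (p : Fin n × Fin n → Bool) →
              cnt p (cartesianProduct (allFin n) (allFin n)) ≡ ∑[ i < n ] ∑[ j < n ] 𝟙 (p (i , j))
cnt-allFin² {n} p = rows id
  where
  rows : ∀ {k} (f : Fin k → Fin n) →
         cnt p (cartesianProduct (tabulate f) (allFin n)) ≡ ∑[ i < k ] ∑[ j < n ] 𝟙 (p (f i , j))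
  rows {zero}  f = refl
  rows {suc k} f = begin
    cnt p (map (f Fin.zero ,_) (allFin n) ++ cartesianProduct (tabulate (f ∘ Fin.suc)) (allFin n))
      ≡⟨ cnt-++ p (map (f Fin.zero ,_) (allFin n)) _ ⟩
    cnt p (map (f Fin.zero ,_) (allFin n)) + cnt p (cartesianProduct (tabulate (f ∘ Fin.suc)) (allFin n))
      ≡⟨ cong₂ _+_ (trans (cnt-map p (f Fin.zero ,_) (allFin n)) (cnt-allFin (p ∘ (f Fin.zero ,_))))
                   (rows (f ∘ Fin.suc)) ⟩
    ∑[ i < suc k ] ∑[ j < n ] 𝟙 (p (f i , j)) ∎
    where open ≡-Reasoning

∑-one : ∀ n → ∑[ i < n ] 1 ≡ n
∑-one zero    = refl
∑-one (suc n) = cong suc (∑-one n)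

count : ∀ {n} → Bool → Vector Bool n → ℕ
count {n} b u = ∑[ i < n ] 𝟙 (beq (u i) b)

disagreements : ∀ {n} → Vector Bool n → Vector Bool n → ℕ
disagreements u v = count false (zipWith beq u v)

count-total : ∀ {n} (u : Vector Bool n) → count false u + count true u ≡ n
count-total {n} u = begin
  count false u + count true u                            ≡⟨ ∑-distrib-+ (λ i → 𝟙 (beq (u i) false)) _ ⟨
  ∑[ i < n ] (𝟙 (beq (u i) false) + 𝟙 (beq (u i) true))  ≡⟨ sum-cong-≗ (λ i → one-of (u i)) ⟩
  ∑[ i < n ] 1                                            ≡⟨ ∑-one n ⟩
  n                                                       ∎
  where
  open ≡-Reasoning
  one-of : ∀ a → 𝟙 (beq a false) + 𝟙 (beq a true) ≡ 1
  one-of true  = refl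
  one-of false = refl

balanced⇒double : ∀ {n} (u : Vector Bool n) → count false u ≡ count true u → count false u + count false u ≡ n
balanced⇒double u balanced = trans (cong (count false u +_) balanced) (count-total u)

balanced-pair : ∀ {a c} → 𝟙 (beq a false) + 𝟙 (beq c false) ≡ 𝟙 (beq a true) + 𝟙 (beq c true) → c ≡ not a
balanced-pair {true}  {false} _ = refl
balanced-pair {false} {true}  _ = refl
balanced-pair {true}  {true}  ()
balanced-pair {false} {false} ()

complementary-cells : ∀ u v b₁ b₂ →
  𝟙 (beq u b₁ ∧ beq v b₂) + 𝟙 (beq (not u) b₁ ∧ beq (not v) b₂) ≡ 𝟙 (beq (beq u v) (beq b₁ b₂))
complementary-cells true  true  true  true  = refl
complementary-cells true  true  true  false = refl
complementary-cells true  true  false true  = refl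
complementary-cells true  true  false false = refl
complementary-cells true  false true  true  = refl
complementary-cells true  false true  false = refl
complementary-cells true  false false true  = refl
complementary-cells true  false false false = refl
complementary-cells false true  true  true  = refl
complementary-cells false true  true  false = refl
complementary-cells false true  false true  = refl
complementary-cells false true  false false = refl
complementary-cells false false true  true  = refl
complementary-cells false false true  false = refl
complementary-cells false false false true  = refl
complementary-cells false false false false = refl

double-injective : ∀ x y → x + x ≡ y + y → x ≡ y
double-injective x y eq = *-cancelˡ-≡ x y 2 (trans (double x) (trans eq (sym (double y))))
  where
  double : ∀ z → 2 * z ≡ z + z
  double z = cong (z +_) (+-identityʳ z)

parity-double : ∀ n → parity (n + n) ≡ 0ℙ
parity-double n = trans (ℙₚ.+-homo-+ n n) (proj₁ ℙₚ.+-inverse (parity n))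

parity-+-double : ∀ a x → parity (a + (x + x)) ≡ parity a
parity-+-double a x = trans (ℙₚ.+-homo-+ a (x + x))
  (trans (cong (parity a ℙ.+_) (parity-double x)) (ℙₚ.+-identityʳ (parity a)))

even⇒parity≡0ℙ : ∀ {n} → 2 ∣ n → parity n ≡ 0ℙ
even⇒parity≡0ℙ (divides q refl) = trans (ℙₚ.*-homo-* q 2) (ℙₚ.*-zeroʳ (parity q))

+≡0ℙ⇒≡ : ∀ {p q : Parity} → p ℙ.+ q ≡ 0ℙ → p ≡ q
+≡0ℙ⇒≡ {p} {q} eq = ℙₚ.+-cancelʳ-≡ q p q (trans eq (sym (proj₁ ℙₚ.+-inverse q)))

equal-zeros⇒even-disagreements : ∀ {n} (u v : Vector Bool n) → count false u ≡ count false v →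
                                 parity (disagreements u v) ≡ 0ℙ
equal-zeros⇒even-disagreements {n} u v zeros-eq = begin
  parity D                                ≡⟨ parity-+-double D C ⟨
  parity (D + (C + C))                    ≡⟨ cong parity split ⟩
  parity (count false u + count false v)  ≡⟨ cong (λ z → parity (count false u + z)) zeros-eq ⟨
  parity (count false u + count false u)  ≡⟨ parity-double (count false u) ⟩
  0ℙ                                      ∎
  where
  open ≡-Reasoning
  both-zero : Fin n → ℕ
  both-zero i = 𝟙 (beq (u i) false ∧ beq (v i) false)
  D C : ℕ
  D = disagreements u v
  C = ∑[ i < n ] both-zero i
  cell : ∀ a b → 𝟙 (beq (beq a b) false) + (𝟙 (beq a false ∧ beq b false) + 𝟙 (beq a false ∧ beq b false))
                 ≡ 𝟙 (beq a false) + 𝟙 (beq b false)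
  cell true  true  = refl
  cell true  false = refl
  cell false true  = refl
  cell false false = refl
  split : D + (C + C) ≡ count false u + count false v
  split = begin
    D + (C + C)
      ≡⟨ cong (D +_) (∑-distrib-+ both-zero both-zero) ⟨
    D + ∑[ i < n ] (both-zero i + both-zero i)
      ≡⟨ ∑-distrib-+ _ (λ i → both-zero i + both-zero i) ⟨
    ∑[ i < n ] (𝟙 (beq (beq (u i) (v i)) false) + (both-zero i + both-zero i))
      ≡⟨ sum-cong-≗ (λ i → cell (u i) (v i)) ⟩
    ∑[ i < n ] (𝟙 (beq (u i) false) + 𝟙 (beq (v i) false))
      ≡⟨ ∑-distrib-+ (λ i → 𝟙 (beq (u i) false)) _ ⟩
    count false u + count false v ∎

balance⇒odd : ∀ {m A B c₀₀ c₀₁ δ} → parity m ≡ 0ℙ → A + B ≡ m + m →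
             A + c₀₀ ≡ B + c₀₁ → c₀₀ + c₀₁ ≡ 2 → parity (B + δ) ≡ 0ℙ →
             parity (c₀₀ + δ) ≡ 1ℙ
balance⇒odd {m} {A} {B} {c₀₀} {c₀₁} {δ} m-even A+B≡2m balance c₀₀+c₀₁≡2 B+δ-even = begin
  parity (c₀₀ + δ)          ≡⟨ ℙₚ.+-homo-+ c₀₀ δ ⟩
  parity c₀₀ ℙ.+ parity δ   ≡⟨ cong (parity c₀₀ ℙ.+_) (+≡0ℙ⇒≡ (trans (sym (ℙₚ.+-homo-+ B δ)) B+δ-even)) ⟨
  parity c₀₀ ℙ.+ parity B   ≡⟨ cong (parity c₀₀ ℙ.+_) (+≡0ℙ⇒≡ A+B-even) ⟨
  parity c₀₀ ℙ.+ parity A   ≡⟨ ℙₚ.+-comm (parity c₀₀) (parity A) ⟩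
  parity A ℙ.+ parity c₀₀   ≡⟨ ℙₚ.+-homo-+ A c₀₀ ⟨
  parity (A + c₀₀)          ≡⟨ cong parity A+c₀₀≡1+m ⟩
  parity (1 + m)            ≡⟨ ℙₚ.+-homo-+ 1 m ⟩
  1ℙ ℙ.+ parity m           ≡⟨ cong (1ℙ ℙ.+_) m-even ⟩
  1ℙ                        ∎
  where
  open ≡-Reasoning
  A+B-even : parity A ℙ.+ parity B ≡ 0ℙ
  A+B-even = trans (sym (ℙₚ.+-homo-+ A B)) (trans (cong parity A+B≡2m) (parity-double m))
  A+c₀₀≡1+m : A + c₀₀ ≡ 1 + m
  A+c₀₀≡1+m = double-injective _ _ (begin
    (A + c₀₀) + (A + c₀₀)  ≡⟨ cong ((A + c₀₀) +_) balance ⟩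
    (A + c₀₀) + (B + c₀₁)  ≡⟨ +-interchange A c₀₀ B c₀₁ ⟩
    (A + B) + (c₀₀ + c₀₁)  ≡⟨ cong₂ _+_ A+B≡2m c₀₀+c₀₁≡2 ⟩
    (m + m) + 2            ≡⟨ +-comm (m + m) 2 ⟩
    2 + (m + m)            ≡⟨ cong suc (+-suc m m) ⟨
    (1 + m) + (1 + m)      ∎)

cellCount : Bool → Bool → Pair → ℕ
cellCount b₁ b₂ (u , v) = 𝟙 (beq u b₁ ∧ beq v b₂)

cornerCount : Bool → Bool → Arr → ℕ
cornerCount b₁ b₂ (arr a b c d) = cellCount b₁ b₂ a + cellCount b₁ b₂ b + cellCount b₁ b₂ c + cellCount b₁ b₂ d

cornerCountSum : Arr → ℕ
cornerCountSum M = cornerCount false false M + cornerCount false true M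
                 + cornerCount true false M + cornerCount true true M

mixed : Pair → Bool
mixed (u , v) = beq (beq u v) false

offDiagonalMixed : Arr → ℕ
offDiagonalMixed (arr _ b c _) = 𝟙 (mixed b) + 𝟙 (mixed c)

admissible : Arr → Bool
admissible M = (cornerCount false false M ≡ᵇ cornerCount true true M)
             ∧ (cornerCount false true M ≡ᵇ cornerCount true false M)
             ∧ ⌊ parity (cornerCount false false M + offDiagonalMixed M) ℙₚ.≟ 1ℙ ⌋

allBool : (Bool → Bool) → Bool
allBool p = p false ∧ p true

allBool-sound : ∀ {p} → T (allBool p) → ∀ b → T (p b)
allBool-sound h false = proj₁ (Equivalence.to T-∧ h)
allBool-sound h true  = proj₂ (Equivalence.to T-∧ h)

allPair : (Pair → Bool) → Bool
allPair p = allBool λ u → allBool λ v → p (u , v)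

allPair-sound : ∀ {p} → T (allPair p) → ∀ x → T (p x)
allPair-sound {p} h (u , v) =
  allBool-sound {λ v → p (u , v)} (allBool-sound {λ u → allBool λ v → p (u , v)} h u) v

allArr : (Arr → Bool) → Bool
allArr p = allPair λ a → allPair λ b → allPair λ c → allPair λ d → p (arr a b c d)

allArr-sound : ∀ {p} → T (allArr p) → ∀ M → T (p M)
allArr-sound {p} h (arr a b c d) =
  allPair-sound {λ d → p (arr a b c d)}
    (allPair-sound {λ c → allPair λ d → p (arr a b c d)}
      (allPair-sound {λ b → allPair λ c → allPair λ d → p (arr a b c d)}
        (allPair-sound {λ a → allPair λ b → allPair λ c → allPair λ d → p (arr a b c d)} h a) b) c) d

_≟ᴬ_ : DecidableEquality Arr
arr a b c d ≟ᴬ arr a′ b′ c′ d′ =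
  map′ (λ { (refl , refl , refl , refl) → refl }) (λ { refl → refl , refl , refl , refl })
       (a ≟ᴾ a′ ×-dec b ≟ᴾ b′ ×-dec c ≟ᴾ c′ ×-dec d ≟ᴾ d′)
  where
  _≟ᴾ_ : DecidableEquality Pair
  _≟ᴾ_ = ≡-dec Bool._≟_ Bool._≟_

cornerCountSum≡4 : ∀ M → cornerCountSum M ≡ 4
cornerCountSum≡4 M = ≡ᵇ⇒≡ _ 4 (allArr-sound {λ M → cornerCountSum M ≡ᵇ 4} _ M)

cornerCount-half : ∀ M → cornerCount false false M ≡ cornerCount true true M →
                   cornerCount false true M ≡ cornerCount true false M →
                   cornerCount false false M + cornerCount false true M ≡ 2
cornerCount-half M c₀₀≡c₁₁ c₀₁≡c₁₀ = double-injective _ 2 (begin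
  (c₀₀ + c₀₁) + (c₀₀ + c₀₁)  ≡⟨ mirror c₀₀ c₀₁ ⟩
  c₀₀ + c₀₁ + c₀₁ + c₀₀      ≡⟨ cong₂ (λ c₁₀ c₁₁ → c₀₀ + c₀₁ + c₁₀ + c₁₁) c₀₁≡c₁₀ c₀₀≡c₁₁ ⟩
  cornerCountSum M           ≡⟨ cornerCountSum≡4 M ⟩
  4                          ∎)
  where
  open ≡-Reasoning
  c₀₀ c₀₁ : ℕ
  c₀₀ = cornerCount false false M
  c₀₁ = cornerCount false true M
  mirror : ∀ a b → (a + b) + (a + b) ≡ a + b + b + a
  mirror = solve-∀

topLeft topRight : Arr → Pair
topLeft  (arr a _ _ _) = a
topRight (arr _ b _ _) = b

applyWhen : (Arr → Bool) → (Arr → Arr) → Arr → Arr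
applyWhen c f M = if c M then f M else M

Iso-applyWhen : ∀ c {f} → (∀ M → Step M (f M)) → ∀ M → Iso M (applyWhen c f M)
Iso-applyWhen c step M with c M
... | true  = step M ◅ ε
... | false = ε

normalise : Arr → Arr
normalise = applyWhen (proj₁ ∘ topRight) transpose
          ∘ applyWhen (proj₂ ∘ topLeft) flip2
          ∘ applyWhen (proj₁ ∘ topLeft) flip1

Iso-normalise : ∀ M → Iso M (normalise M)
Iso-normalise M = Iso-applyWhen (proj₁ ∘ topLeft) st-flip1 M
               ◅◅ Iso-applyWhen (proj₂ ∘ topLeft) st-flip2 _
               ◅◅ Iso-applyWhen (proj₁ ∘ topRight) st-trans _

admissible⇒Iso-target : ∀ M → T (admissible M) → Iso M target
admissible⇒Iso-target M adm =
  subst (Iso M) (toWitness (modusPonens (allArr-sound {test} _ M) adm)) (Iso-normalise M)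
  where
  test : Arr → Bool
  test M = not (admissible M) ∨ ⌊ normalise M ≟ᴬ target ⌋
  modusPonens : ∀ {a b} → T (not a ∨ b) → T a → T b
  modusPonens {true} b _ = b

≤⇒<ᵇ≡false : ∀ {m n} → m ≤ n → (n <ᵇ m) ≡ false
≤⇒<ᵇ≡false z≤n     = refl
≤⇒<ᵇ≡false (s≤s p) = ≤⇒<ᵇ≡false p

<⇒<ᵇ≡true : ∀ {m n} → m < n → (m <ᵇ n) ≡ true
<⇒<ᵇ≡true m<n = Equivalence.to T-≡ (<⇒<ᵇ m<n)

filled-hole : ∀ {s n} {r c : Fin n} → toℕ r < s → toℕ c < s → filled s r c ≡ false
filled-hole r<s c<s rewrite <⇒<ᵇ≡true r<s | <⇒<ᵇ≡true c<s = refl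

filled-outsideˡ : ∀ {s n} {r c : Fin n} → s ≤ toℕ r → filled s r c ≡ true
filled-outsideˡ s≤r rewrite ≤⇒<ᵇ≡false s≤r = refl

filled-outsideʳ : ∀ {s n} {r c : Fin n} → s ≤ toℕ c → filled s r c ≡ true
filled-outsideʳ s≤c rewrite ≤⇒<ᵇ≡false s≤c = cong not (∧-zeroʳ _)

∑-full-line : ∀ {n} (g φ : Vector Bool n) → (∀ j → g j ≡ true) →
              ∑[ j < n ] 𝟙 (g j ∧ φ j) ≡ ∑[ j < n ] 𝟙 (φ j)
∑-full-line g φ full = sum-cong-≗ (λ j → cong (λ t → 𝟙 (t ∧ φ j)) (full j))

col : ∀ {n} → Square n → Fin n → Vector Bool n
col F c r = F r c

module Hole (m : ℕ) where

  ι : Fin m → Fin (suc (suc m))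
  ι = inject₁ ∘ inject₁

  X Y : Fin (suc (suc m))
  X = inject₁ (fromℕ m)
  Y = fromℕ (suc m)

  ι-inside : ∀ i → toℕ (ι i) < m
  ι-inside i = subst (_< m) (sym (trans (toℕ-inject₁ (inject₁ i)) (toℕ-inject₁ i))) (toℕ<n i)

  X-outside : m ≤ toℕ X
  X-outside = ≤-reflexive (sym (trans (toℕ-inject₁ (fromℕ m)) (toℕ-fromℕ m)))

  Y-outside : m ≤ toℕ Y
  Y-outside = subst (m ≤_) (sym (toℕ-fromℕ (suc m))) (n≤1+n m)

  ∑-split : (f : Vector ℕ (suc (suc m))) → sum f ≡ ∑[ i < m ] f (ι i) + f X + f Y
  ∑-split f = trans (sum-init-last f) (cong (_+ f Y) (sum-init-last (f ∘ inject₁)))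

  count-split : ∀ b u → count b u ≡ count b (u ∘ ι) + 𝟙 (beq (u X) b) + 𝟙 (beq (u Y) b)
  count-split b u = ∑-split (λ i → 𝟙 (beq (u i) b))

  ∑-hole-line : (g φ : Vector Bool (suc (suc m))) → (∀ j → g (ι j) ≡ false) → g X ≡ true → g Y ≡ true →
                ∑[ j < suc (suc m) ] 𝟙 (g j ∧ φ j) ≡ 𝟙 (φ X) + 𝟙 (φ Y)
  ∑-hole-line g φ hole gX gY = trans (∑-split (λ j → 𝟙 (g j ∧ φ j)))
    (cong₂ _+_ (cong₂ _+_ inside (cong (λ t → 𝟙 (t ∧ φ X)) gX)) (cong (λ t → 𝟙 (t ∧ φ Y)) gY))
    where
    inside : ∑[ j < m ] 𝟙 (g (ι j) ∧ φ (ι j)) ≡ 0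
    inside = trans (sum-cong-≗ (λ j → cong (λ t → 𝟙 (t ∧ φ (ι j))) (hole j))) (sum-replicate-zero m)

  module Frequency (F : Square (suc (suc m))) (sq : IFS (suc (suc m)) m F) where

    rowCount-hole : ∀ i b → rowCount m F (ι i) b ≡ 𝟙 (beq (F (ι i) X) b) + 𝟙 (beq (F (ι i) Y) b)
    rowCount-hole i b = trans (cnt-allFin (λ j → filled m (ι i) j ∧ beq (F (ι i) j) b))
      (∑-hole-line (filled m (ι i)) (λ j → beq (F (ι i) j) b) (λ j → filled-hole (ι-inside i) (ι-inside j))
                   (filled-outsideʳ X-outside) (filled-outsideʳ Y-outside))

    colCount-hole : ∀ j b → colCount m F (ι j) b ≡ 𝟙 (beq (F X (ι j)) b) + 𝟙 (beq (F Y (ι j)) b)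
    colCount-hole j b = trans (cnt-allFin (λ i → filled m i (ι j) ∧ beq (F i (ι j)) b))
      (∑-hole-line (λ i → filled m i (ι j)) (λ i → beq (F i (ι j)) b) (λ i → filled-hole (ι-inside i) (ι-inside j))
                   (filled-outsideˡ X-outside) (filled-outsideˡ Y-outside))

    arm-row : ∀ i → F (ι i) Y ≡ not (F (ι i) X)
    arm-row i = balanced-pair
      (trans (sym (rowCount-hole i false)) (trans (IFS.rowBal sq (ι i)) (rowCount-hole i true)))

    arm-col : ∀ j → F Y (ι j) ≡ not (F X (ι j))
    arm-col j = balanced-pair
      (trans (sym (colCount-hole j false)) (trans (IFS.colBal sq (ι j)) (colCount-hole j true)))

    zeros-row-X : count false (F X) + count false (F X) ≡ suc (suc m)
    zeros-row-X = balanced⇒double (F X)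
      (trans (sym (rowCount-X false)) (trans (IFS.rowBal sq X) (rowCount-X true)))
      where
      rowCount-X : ∀ b → rowCount m F X b ≡ count b (F X)
      rowCount-X b = trans (cnt-allFin (λ j → filled m X j ∧ beq (F X j) b))
        (∑-full-line (filled m X) (λ j → beq (F X j) b) (λ _ → filled-outsideˡ X-outside))

    zeros-col-X : count false (col F X) + count false (col F X) ≡ suc (suc m)
    zeros-col-X = balanced⇒double (col F X)
      (trans (sym (colCount-X false)) (trans (IFS.colBal sq X) (colCount-X true)))
      where
      colCount-X : ∀ b → colCount m F X b ≡ count b (col F X)
      colCount-X b = trans (cnt-allFin (λ i → filled m i X ∧ beq (F i X) b))
        (∑-full-line (λ i → filled m i X) (λ i → beq (F i X) b) (λ _ → filled-outsideʳ X-outside))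

  module Orthogonality (F1 F2 : Square (suc (suc m))) (im : IMOFS2 (suc (suc m)) m F1 F2) where

    module F₁ = Frequency F1 (IMOFS2.sq1 im)
    module F₂ = Frequency F2 (IMOFS2.sq2 im)

    M : Arr
    M = corner (suc (suc m)) F1 F2

    -- Whether F1 and F2 agree on the X-cell of each row, resp. column, meeting the hole.
    rowArmAgreement colArmAgreement : Vector Bool m
    rowArmAgreement = zipWith beq (col F1 X ∘ ι) (col F2 X ∘ ι)
    colArmAgreement = zipWith beq (F1 X ∘ ι) (F2 X ∘ ι)

    arms : Bool → ℕ
    arms β = count β rowArmAgreement + count β colArmAgreement

    pairCount-split : ∀ b₁ b₂ → pairCount m F1 F2 b₁ b₂ ≡ arms (beq b₁ b₂) + cornerCount b₁ b₂ M
    pairCount-split b₁ b₂ = begin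
      pairCount m F1 F2 b₁ b₂
        ≡⟨ cnt-allFin² (λ { (r , c) → filled m r c ∧ φ r c }) ⟩
      sum L
        ≡⟨ ∑-split L ⟩
      ∑[ i < m ] L (ι i) + L X + L Y
        ≡⟨ cong₂ _+_ (cong₂ _+_ (sum-cong-≗ hole-row) (full-row X X-outside)) (full-row Y Y-outside) ⟩
      count β rowArmAgreement + (Σ[X] + 𝟙 (φ X X) + 𝟙 (φ X Y)) + (Σ[Y] + 𝟙 (φ Y X) + 𝟙 (φ Y Y))
        ≡⟨ regroup (count β rowArmAgreement) Σ[X] Σ[Y] (𝟙 (φ X X)) (𝟙 (φ X Y)) (𝟙 (φ Y X)) (𝟙 (φ Y Y)) ⟩
      count β rowArmAgreement + (Σ[X] + Σ[Y]) + cornerCount b₁ b₂ M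
        ≡⟨ cong (λ z → count β rowArmAgreement + z + cornerCount b₁ b₂ M) hole-cols ⟩
      arms β + cornerCount b₁ b₂ M ∎
      where
      open ≡-Reasoning
      β : Bool
      β = beq b₁ b₂
      φ : Fin (suc (suc m)) → Fin (suc (suc m)) → Bool
      φ r c = beq (F1 r c) b₁ ∧ beq (F2 r c) b₂
      L : Vector ℕ (suc (suc m))
      L r = ∑[ c < suc (suc m) ] 𝟙 (filled m r c ∧ φ r c)
      Σ[X] Σ[Y] : ℕ
      Σ[X] = ∑[ j < m ] 𝟙 (φ X (ι j))
      Σ[Y] = ∑[ j < m ] 𝟙 (φ Y (ι j))
      arm : ∀ {u v u′ v′} → u′ ≡ not u → v′ ≡ not v →
            𝟙 (beq u b₁ ∧ beq v b₂) + 𝟙 (beq u′ b₁ ∧ beq v′ b₂) ≡ 𝟙 (beq (beq u v) β)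
      arm {u} {v} refl refl = complementary-cells u v b₁ b₂
      hole-row : ∀ i → L (ι i) ≡ 𝟙 (beq (rowArmAgreement i) β)
      hole-row i = trans
        (∑-hole-line (filled m (ι i)) (φ (ι i)) (λ j → filled-hole (ι-inside i) (ι-inside j))
                     (filled-outsideʳ X-outside) (filled-outsideʳ Y-outside))
        (arm (F₁.arm-row i) (F₂.arm-row i))
      hole-cols : Σ[X] + Σ[Y] ≡ count β colArmAgreement
      hole-cols = trans (sym (∑-distrib-+ (λ j → 𝟙 (φ X (ι j))) _))
                        (sum-cong-≗ (λ j → arm (F₁.arm-col j) (F₂.arm-col j)))
      full-row : ∀ r → m ≤ toℕ r → L r ≡ ∑[ j < m ] 𝟙 (φ r (ι j)) + 𝟙 (φ r X) + 𝟙 (φ r Y)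
      full-row r outside = trans (∑-full-line (filled m r) (φ r) (λ _ → filled-outsideˡ outside))
                                 (∑-split (λ j → 𝟙 (φ r j)))
      regroup : ∀ r x y a b c d → r + (x + a + b) + (y + c + d) ≡ r + (x + y) + (a + b + c + d)
      regroup = solve-∀

    arms-total : arms true + arms false ≡ m + m
    arms-total = begin
      arms true + arms false
        ≡⟨ +-interchange (count true rowArmAgreement) _ (count false rowArmAgreement) _ ⟩
      (count true rowArmAgreement + count false rowArmAgreement)
        + (count true colArmAgreement + count false colArmAgreement)
        ≡⟨ cong₂ _+_ (trans (+-comm (count true rowArmAgreement) _) (count-total rowArmAgreement))
                     (trans (+-comm (count true colArmAgreement) _) (count-total colArmAgreement)) ⟩
      m + m ∎
      where open ≡-Reasoning

    col-X-disagreements-even : parity (disagreements (col F1 X) (col F2 X)) ≡ 0ℙ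
    col-X-disagreements-even = equal-zeros⇒even-disagreements (col F1 X) (col F2 X)
      (double-injective (count false (col F1 X)) (count false (col F2 X)) (trans F₁.zeros-col-X (sym F₂.zeros-col-X)))

    row-X-disagreements-even : parity (disagreements (F1 X) (F2 X)) ≡ 0ℙ
    row-X-disagreements-even = equal-zeros⇒even-disagreements (F1 X) (F2 X)
      (double-injective (count false (F1 X)) (count false (F2 X)) (trans F₁.zeros-row-X (sym F₂.zeros-row-X)))

    arms-mixed-even : parity (arms false + offDiagonalMixed M) ≡ 0ℙ
    arms-mixed-even = begin
      parity (arms false + offDiagonalMixed M)
        ≡⟨ parity-+-double (arms false + offDiagonalMixed M) xx ⟨
      parity (arms false + offDiagonalMixed M + (xx + xx))
        ≡⟨ cong parity (regroup (count false rowArmAgreement) (count false colArmAgreement) xx xy yx) ⟩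
      parity ((count false rowArmAgreement + xx + yx) + (count false colArmAgreement + xx + xy))
        ≡⟨ cong₂ (λ p q → parity (p + q)) (sym (count-split false (zipWith beq (col F1 X) (col F2 X))))
                                           (sym (count-split false (zipWith beq (F1 X) (F2 X)))) ⟩
      parity (disagreements (col F1 X) (col F2 X) + disagreements (F1 X) (F2 X))
        ≡⟨ ℙₚ.+-homo-+ (disagreements (col F1 X) (col F2 X)) _ ⟩
      parity (disagreements (col F1 X) (col F2 X)) ℙ.+ parity (disagreements (F1 X) (F2 X))
        ≡⟨ cong₂ ℙ._+_ col-X-disagreements-even row-X-disagreements-even ⟩
      0ℙ ∎
      where
      open ≡-Reasoning
      xx xy yx : ℕ
      xx = 𝟙 (mixed (F1 X X , F2 X X))
      xy = 𝟙 (mixed (F1 X Y , F2 X Y))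
      yx = 𝟙 (mixed (F1 Y X , F2 Y X))
      regroup : ∀ a b x y z → a + b + (y + z) + (x + x) ≡ (a + x + z) + (b + x + y)
      regroup = solve-∀

    pc₀₀≡pc₀₁ : pairCount m F1 F2 false false ≡ pairCount m F1 F2 false true
    pc₀₀≡pc₀₁ = proj₁ (IMOFS2.orth im)

    pc₀₀≡pc₁₀ : pairCount m F1 F2 false false ≡ pairCount m F1 F2 true false
    pc₀₀≡pc₁₀ = proj₁ (proj₂ (IMOFS2.orth im))

    pc₀₀≡pc₁₁ : pairCount m F1 F2 false false ≡ pairCount m F1 F2 true true
    pc₀₀≡pc₁₁ = proj₂ (proj₂ (IMOFS2.orth im))

    c₀₀≡c₁₁ : cornerCount false false M ≡ cornerCount true true M
    c₀₀≡c₁₁ = +-cancelˡ-≡ (arms true) _ _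
      (trans (sym (pairCount-split false false)) (trans pc₀₀≡pc₁₁ (pairCount-split true true)))

    c₀₁≡c₁₀ : cornerCount false true M ≡ cornerCount true false M
    c₀₁≡c₁₀ = +-cancelˡ-≡ (arms false) _ _
      (trans (sym (pairCount-split false true)) (trans (sym pc₀₀≡pc₀₁) (trans pc₀₀≡pc₁₀ (pairCount-split true false))))

    arms-balance : arms true + cornerCount false false M ≡ arms false + cornerCount false true M
    arms-balance = trans (sym (pairCount-split false false)) (trans pc₀₀≡pc₀₁ (pairCount-split false true))

    corner-odd : parity (cornerCount false false M + offDiagonalMixed M) ≡ 1ℙ
    corner-odd = balance⇒odd {m} {arms true} {arms false} {cornerCount false false M} {cornerCount false true M}
      (even⇒parity≡0ℙ (IFS.s-even (IMOFS2.sq1 im))) arms-total arms-balance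
      (cornerCount-half M c₀₀≡c₁₁ c₀₁≡c₁₀) arms-mixed-even

    corner-admissible : T (admissible M)
    corner-admissible = Equivalence.from T-∧
      (≡⇒≡ᵇ _ _ c₀₀≡c₁₁ , Equivalence.from T-∧ (≡⇒≡ᵇ _ _ c₀₁≡c₁₀ , fromWitness corner-odd))

lemma6p2 : (n : ℕ) → 4 ≤ n → 2 ∣ n → (F1 F2 : Square n) →
    IMOFS2 n (n ∸ 2) F1 F2 → Iso (corner n F1 F2) target
lemma6p2 (suc (suc m)) _ _ F1 F2 im =
  admissible⇒Iso-target (corner (suc (suc m)) F1 F2) (Hole.Orthogonality.corner-admissible m F1 F2 im)
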